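{- Let $k$ be a field and $u,v\in k^\times$. Let $$T_{u,v}=\{(u^2:u:1),\ (u^{ -2}:u^{ -1}:1),\ (v^2:v:1),\ (v^{ -2}:v^{ -1}:1),\ (1:0:0),\ (0:1:0)\}\subset\mathbb{P}^2(k)$$ and $f(u,v)=(u^4-1)(v^4-1)(u^2-v^2)(u^2v^2-1)$. Then the six points of $T_{u,v}$ are in general position if and only if $f(u,v)\neq 0$.
   Context: Points $P_1,\dots,P_n$ ($1\le n\le 8$) of $\mathbb{P}^2_k$ are in general position if they are distinct, no three lie on a line, no six lie on a conic, and no eight lie on a singular cubic with one of the eight at the singular point. -}

module Defs where

open import Level using (Level; _⊔_)
open import Algebra.Bundles using (CommutativeRing)
open import Data.Fin using (Fin; zero; suc)
open import Data.Nat using (ℕ)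
open import Data.Product using (Σ; ∃; _×_; _,_)
open import Relation.Nullary using (¬_)
open import Function.Definitions using (Injective)
open import Relation.Binary.PropositionalEquality using (_≡_)

record Field (c ℓ : Level) : Set (Level.suc (c ⊔ ℓ)) where
  field
    commRing : CommutativeRing c ℓ
  open CommutativeRing commRing public
  field
    1≉0     : ¬ (1# ≈ 0#)
    inv     : (x : Carrier) → ¬ (x ≈ 0#) → Carrier
    inv-law : (x : Carrier) (x≉0 : ¬ (x ≈ 0#)) → x * inv x x≉0 ≈ 1#

module _ {c ℓ : Level} (K : Field c ℓ) where
  open Field K using (Carrier; _≈_; _+_; _*_; _-_; 0#; 1#; 1≉0; inv)

  record P2 : Set (c ⊔ ℓ) where
    constructor ⟨_∶_∶_⟩[_]
    field
      px py pz : Carrier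
      nonzero  : ¬ ((px ≈ 0#) × (py ≈ 0#) × (pz ≈ 0#))
  open P2 public

  SamePoint : P2 → P2 → Set (c ⊔ ℓ)
  SamePoint p q = Σ Carrier λ t → ¬ (t ≈ 0#) ×
    ((px p ≈ t * px q) × (py p ≈ t * py q) × (pz p ≈ t * pz q))

  NonZeroCoeffs : {m : ℕ} → (Fin m → Carrier) → Set ℓ
  NonZeroCoeffs a = ¬ (∀ i → a i ≈ 0#)

  evalLine : (Fin 3 → Carrier) → P2 → Carrier
  evalLine a p = a zero * px p + a (suc zero) * py p + a (suc (suc zero)) * pz p

  evalConic : (Fin 6 → Carrier) → P2 → Carrier
  evalConic a p =
    a zero * (x * x) + a (suc zero) * (y * y) + a (suc (suc zero)) * (z * z)
    + a (suc (suc (suc zero))) * (x * y)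
    + a (suc (suc (suc (suc zero)))) * (x * z)
    + a (suc (suc (suc (suc (suc zero))))) * (y * z)
    where x = px p ; y = py p ; z = pz p

  2# 3# : Carrier
  2# = 1# + 1#
  3# = 1# + 1# + 1#

  module _ (a : Fin 10 → Carrier) (p : P2) where
    private
      x = px p ; y = py p ; z = pz p
      c0 = a zero
      c1 = a (suc zero)
      c2 = a (suc (suc zero))
      c3 = a (suc (suc (suc zero)))
      c4 = a (suc (suc (suc (suc zero))))
      c5 = a (suc (suc (suc (suc (suc zero)))))
      c6 = a (suc (suc (suc (suc (suc (suc zero))))))
      c7 = a (suc (suc (suc (suc (suc (suc (suc zero)))))))
      c8 = a (suc (suc (suc (suc (suc (suc (suc (suc zero))))))))
      c9 = a (suc (suc (suc (suc (suc (suc (suc (suc (suc zero)))))))))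

    evalCubic : Carrier
    evalCubic = c0 * (x * x * x) + c1 * (y * y * y) + c2 * (z * z * z)
      + c3 * (x * x * y) + c4 * (x * x * z) + c5 * (y * y * x)
      + c6 * (y * y * z) + c7 * (z * z * x) + c8 * (z * z * y)
      + c9 * (x * y * z)

    ∂xCubic : Carrier
    ∂xCubic = 3# * c0 * (x * x) + 2# * c3 * (x * y) + 2# * c4 * (x * z)
      + c5 * (y * y) + c7 * (z * z) + c9 * (y * z)

    ∂yCubic : Carrier
    ∂yCubic = 3# * c1 * (y * y) + c3 * (x * x) + 2# * c5 * (y * x)
      + 2# * c6 * (y * z) + c8 * (z * z) + c9 * (x * z)

    ∂zCubic : Carrier
    ∂zCubic = 3# * c2 * (z * z) + c4 * (x * x) + c6 * (y * y)
      + 2# * c7 * (z * x) + 2# * c8 * (z * y) + c9 * (x * y)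

  SingularAt : (Fin 10 → Carrier) → P2 → Set ℓ
  SingularAt a p = (evalCubic a p ≈ 0#) × (∂xCubic a p ≈ 0#)
                 × (∂yCubic a p ≈ 0#) × (∂zCubic a p ≈ 0#)

  Choose : ℕ → ℕ → Set
  Choose m n = Σ (Fin m → Fin n) λ s → Injective _≡_ _≡_ s

  record GeneralPosition {n : ℕ} (P : Fin n → P2) : Set (c ⊔ ℓ) where
    field
      distinct  : ∀ i j → ¬ (i ≡ j) → ¬ SamePoint (P i) (P j)
      noLine    : (s : Choose 3 n) → ¬ (Σ (Fin 3 → Carrier) λ a →
                    NonZeroCoeffs a × (∀ i → evalLine a (P (Σ.proj₁ s i)) ≈ 0#))
      noConic   : (s : Choose 6 n) → ¬ (Σ (Fin 6 → Carrier) λ a →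
                    NonZeroCoeffs a × (∀ i → evalConic a (P (Σ.proj₁ s i)) ≈ 0#))
      noSingCub : (s : Choose 8 n) → ¬ (Σ (Fin 10 → Carrier) λ a →
                    NonZeroCoeffs a × (∀ i → evalCubic a (P (Σ.proj₁ s i)) ≈ 0#)
                    × SingularAt a (P (Σ.proj₁ s zero)))

  module _ (u v : Carrier) (u≉0 : ¬ (u ≈ 0#)) (v≉0 : ¬ (v ≈ 0#)) where
    private
      z1 : ∀ {a b : Carrier} → ¬ ((a ≈ 0#) × (b ≈ 0#) × (1# ≈ 0#))
      z1 (_ , _ , e) = 1≉0 e
      u⁻¹ = inv u u≉0
      v⁻¹ = inv v v≉0

    T : Fin 6 → P2
    T zero = ⟨ u * u ∶ u ∶ 1# ⟩[ z1 ]
    T (suc zero) = ⟨ u⁻¹ * u⁻¹ ∶ u⁻¹ ∶ 1# ⟩[ z1 ]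
    T (suc (suc zero)) = ⟨ v * v ∶ v ∶ 1# ⟩[ z1 ]
    T (suc (suc (suc zero))) = ⟨ v⁻¹ * v⁻¹ ∶ v⁻¹ ∶ 1# ⟩[ z1 ]
    T (suc (suc (suc (suc zero)))) = ⟨ 1# ∶ 0# ∶ 0# ⟩[ (λ { (e , _ , _) → 1≉0 e }) ]
    T (suc (suc (suc (suc (suc zero))))) = ⟨ 0# ∶ 1# ∶ 0# ⟩[ (λ { (_ , e , _) → 1≉0 e }) ]

  f : Carrier → Carrier → Carrier
  f u v = (u * u * u * u - 1#) * (v * v * v * v - 1#) * (u * u - v * v)
          * (u * u * (v * v) - 1#)

-- The points (r² : r : 1) for r ∈ {u, u⁻¹, v, v⁻¹} and (1 : 0 : 0) lie on the conic y² = xz,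
-- parametrised by (s : t) ↦ (s² : st : t²), and (0 : 1 : 0) is the pole of the line y = 0 with
-- respect to it. A line restricts to a binary quadratic form in (s : t), so by Cramer's rule for
-- the Vandermonde system it contains at most two points of the conic with distinct parameters;
-- a line through the pole has no y-term and meets the conic in pairs of parameters with equal
-- squares. Hence no three of the six points are collinear (and no two coincide) exactly when
-- u², u⁻², v², v⁻² are pairwise distinct. A conic through all six points loses its x² and y²
-- terms at (1 : 0 : 0) and (0 : 1 : 0), and what is left on y² = xz is a cubic in r with the four
-- roots u, u⁻¹, v, v⁻¹, so it vanishes. Eight of six points cannot be chosen. Finally each factor
-- of f(u, v) is a unit multiple of one of the differences of squares.
module Submission where

open import Defs
open import Level using (Level)
open import Relation.Nullary using (¬_)
open import Function.Bundles using (_⇔_)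

open import Level using (0ℓ; _⊔_)
open import Algebra.Bundles using (CommutativeRing; RawRing)
open import Data.Empty using (⊥-elim)
open import Data.Fin using (Fin; zero; suc; fromℕ; inject₁; punchOut)
open import Data.Fin.Patterns using (0F; 1F; 2F; 3F; 4F; 5F)
open import Data.Fin.Properties
  using (_≟_; any?; punchOut-injective; <⇒notInjective; inject₁-injective; fromℕ≢inject₁)
open import Data.Fin.Relation.Unary.Top using (View; view; ‵fromℕ; ‵inject₁)
open import Data.Maybe using (Maybe; just; nothing)
open import Data.Nat as ℕ using (ℕ)
open import Data.Nat.Properties using (n<1+n; <-trans)
open import Data.Product using (_×_; _,_; Σ; ∃; proj₁; proj₂)
open import Data.Product.Properties using (≡-dec)
open import Data.Vec using (Vec; []; _∷_; lookup)
open import Data.Vec.Relation.Unary.All using (All; []; _∷_)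
open import Data.Vec.Relation.Unary.All.Properties using (lookup⁺)
open import Data.Vec.Relation.Unary.AllPairs as AllPairs using (AllPairs; []; _∷_)
open import Data.Vec.Relation.Unary.Unique.Propositional using (Unique)
open import Data.Vec.Relation.Unary.Unique.Propositional.Properties using (lookup-injective)
open import Function using (_∘_)
open import Function.Bundles using (mk⇔)
open import Function.Definitions using (Injective)
import Function.Properties.Equivalence as ⇔
open import Relation.Binary.Core using (Rel)
open import Relation.Binary.Definitions using (Symmetric)
open import Relation.Binary.PropositionalEquality as ≡ using (_≡_; _≢_; cong)
open import Relation.Nullary using (yes; no; contradiction)

module CommutativeRingSolver {c ℓ : Level} (R : CommutativeRing c ℓ) where
  open CommutativeRing R hiding (zero)
  open import Data.Nat.Base using (zero; suc)
  open import Algebra.Properties.Semiring.Mult.TCOptimised semiring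
    using (1+×; ×-homo-+; ×1-homo-*) renaming (_×_ to _·_)
  open import Algebra.Properties.Ring ring using (-‿distribʳ-*; x[y-z]≈xy-xz; [y-z]x≈yx-zx)
  open import Algebra.Properties.AbelianGroup +-abelianGroup using (⁻¹-∙-comm; ⁻¹-anti-homo‿-)
  open import Algebra.Properties.Group +-group using (ε⁻¹≈ε)
  open import Algebra.Properties.CommutativeSemigroup +-commutativeSemigroup using (interchange)
  open import Algebra.Solver.Ring.AlmostCommutativeRing
    using (fromCommutativeRing; _-Raw-AlmostCommutative⟶_)
  open import Relation.Binary.Reasoning.Setoid setoid

  -- Integer coefficients are pairs (a , b) standing for a − b, normalised so that equal integers
  -- are equal pairs. ⟦_⟧ is split into cases so that the constants (0 , 0), (1 , 0) and (0 , 1)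
  -- denote 0#, 1# and - 1# definitionally: the solver closes goals by refl on normal forms.
  private
    Diff : Set
    Diff = ℕ × ℕ

    normalise : ℕ → ℕ → Diff
    normalise (suc a) (suc b) = normalise a b
    normalise a       b       = a , b

    diff-rawRing : RawRing 0ℓ 0ℓ
    diff-rawRing = record
      { Carrier = Diff
      ; _≈_     = _≡_
      ; _+_     = λ (a , b) (c , d) → normalise (a ℕ.+ c) (b ℕ.+ d)
      ; _*_     = λ (a , b) (c , d) → normalise (a ℕ.* c ℕ.+ b ℕ.* d) (a ℕ.* d ℕ.+ b ℕ.* c)
      ; -_      = λ (a , b) → b , a
      ; 0#      = 0 , 0
      ; 1#      = 1 , 0
      }

    ⟦_⟧ : Diff → Carrier
    ⟦ a    , zero ⟧ = a · 1#
    ⟦ zero , b    ⟧ = - (b · 1#)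
    ⟦ a    , b    ⟧ = a · 1# - b · 1#

    ⟦⟧-sound : ∀ a b → ⟦ a , b ⟧ ≈ a · 1# - b · 1#
    ⟦⟧-sound a       zero    = sym (trans (+-congˡ ε⁻¹≈ε) (+-identityʳ (a · 1#)))
    ⟦⟧-sound zero    (suc b) = sym (+-identityˡ _)
    ⟦⟧-sound (suc a) (suc b) = refl

    sub-+ : ∀ w x y z → (w + x) - (y + z) ≈ (w - y) + (x - z)
    sub-+ w x y z = begin
      (w + x) - (y + z)      ≈⟨ +-congˡ (⁻¹-∙-comm y z) ⟨
      (w + x) + (- y + - z)  ≈⟨ interchange w x (- y) (- z) ⟩
      (w - y) + (x - z)      ∎

    sub-* : ∀ w x y z → (w * y + x * z) - (w * z + x * y) ≈ (w - x) * (y - z)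
    sub-* w x y z = begin
      (w * y + x * z) - (w * z + x * y)  ≈⟨ sub-+ (w * y) (x * z) (w * z) (x * y) ⟩
      (w * y - w * z) + (x * z - x * y)  ≈⟨ +-cong (x[y-z]≈xy-xz w y z) (x[y-z]≈xy-xz x z y) ⟨
      w * (y - z) + x * (z - y)          ≈⟨ +-congˡ (*-congˡ (⁻¹-anti-homo‿- y z)) ⟨
      w * (y - z) + x * - (y - z)        ≈⟨ +-congˡ (-‿distribʳ-* x (y - z)) ⟨
      w * (y - z) - x * (y - z)          ≈⟨ [y-z]x≈yx-zx (y - z) w x ⟨
      (w - x) * (y - z)                  ∎

    normalise-sound : ∀ a b → ⟦ normalise a b ⟧ ≈ a · 1# - b · 1#
    normalise-sound zero    b       = ⟦⟧-sound zero b
    normalise-sound (suc a) zero    = ⟦⟧-sound (suc a) zero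
    normalise-sound (suc a) (suc b) = begin
      ⟦ normalise a b ⟧              ≈⟨ normalise-sound a b ⟩
      a · 1# - b · 1#                ≈⟨ +-identityˡ _ ⟨
      0# + (a · 1# - b · 1#)         ≈⟨ +-congʳ (-‿inverseʳ 1#) ⟨
      (1# - 1#) + (a · 1# - b · 1#)  ≈⟨ sub-+ 1# (a · 1#) 1# (b · 1#) ⟨
      (1# + a · 1#) - (1# + b · 1#)  ≈⟨ +-cong (1+× a 1#) (-‿cong (1+× b 1#)) ⟨
      suc a · 1# - suc b · 1#        ∎

    ×1-homo-+* : ∀ a b c d → (a ℕ.* c ℕ.+ b ℕ.* d) · 1# ≈ a · 1# * c · 1# + b · 1# * d · 1#
    ×1-homo-+* a b c d =
      trans (×-homo-+ 1# (a ℕ.* c) (b ℕ.* d)) (+-cong (×1-homo-* a c) (×1-homo-* b d))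

    homomorphism : diff-rawRing -Raw-AlmostCommutative⟶ fromCommutativeRing R
    homomorphism = record
      { ⟦_⟧    = ⟦_⟧
      ; +-homo = λ (a , b) (c , d) → begin
          ⟦ normalise (a ℕ.+ c) (b ℕ.+ d) ⟧      ≈⟨ normalise-sound (a ℕ.+ c) (b ℕ.+ d) ⟩
          (a ℕ.+ c) · 1# - (b ℕ.+ d) · 1#
            ≈⟨ +-cong (×-homo-+ 1# a c) (-‿cong (×-homo-+ 1# b d)) ⟩
          (a · 1# + c · 1#) - (b · 1# + d · 1#)  ≈⟨ sub-+ _ _ _ _ ⟩
          (a · 1# - b · 1#) + (c · 1# - d · 1#)  ≈⟨ +-cong (⟦⟧-sound a b) (⟦⟧-sound c d) ⟨
          ⟦ a , b ⟧ + ⟦ c , d ⟧                  ∎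
      ; *-homo = λ (a , b) (c , d) → begin
          ⟦ normalise (a ℕ.* c ℕ.+ b ℕ.* d) (a ℕ.* d ℕ.+ b ℕ.* c) ⟧
            ≈⟨ normalise-sound (a ℕ.* c ℕ.+ b ℕ.* d) (a ℕ.* d ℕ.+ b ℕ.* c) ⟩
          (a ℕ.* c ℕ.+ b ℕ.* d) · 1# - (a ℕ.* d ℕ.+ b ℕ.* c) · 1#
            ≈⟨ +-cong (×1-homo-+* a b c d) (-‿cong (×1-homo-+* a b d c)) ⟩
          (a · 1# * c · 1# + b · 1# * d · 1#) - (a · 1# * d · 1# + b · 1# * c · 1#)
            ≈⟨ sub-* _ _ _ _ ⟩
          (a · 1# - b · 1#) * (c · 1# - d · 1#)
            ≈⟨ *-cong (⟦⟧-sound a b) (⟦⟧-sound c d) ⟨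
          ⟦ a , b ⟧ * ⟦ c , d ⟧
            ∎
      ; -‿homo = λ (a , b) → begin
          ⟦ b , a ⟧            ≈⟨ ⟦⟧-sound b a ⟩
          b · 1# - a · 1#      ≈⟨ ⁻¹-anti-homo‿- (a · 1#) (b · 1#) ⟨
          - (a · 1# - b · 1#)  ≈⟨ -‿cong (⟦⟧-sound a b) ⟨
          - ⟦ a , b ⟧          ∎
      ; 0-homo = refl
      ; 1-homo = refl
      }

    equal? : ∀ x y → Maybe (⟦ x ⟧ ≈ ⟦ y ⟧)
    equal? x y with ≡-dec ℕ._≟_ ℕ._≟_ x y
    ... | yes ≡.refl = just refl
    ... | no  _      = nothing

  open import Algebra.Solver.Ring diff-rawRing (fromCommutativeRing R) homomorphism equal? public

module _ {a r} {A : Set a} {R : Rel A r} (sym : Symmetric R) where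

  allPairs-lookup : ∀ {n} {xs : Vec A n} → AllPairs R xs →
                    ∀ {i j} → i ≢ j → R (lookup xs i) (lookup xs j)
  allPairs-lookup (_  ∷ _)   {zero}  {zero}  i≢j = contradiction ≡.refl i≢j
  allPairs-lookup (Rx ∷ _)   {zero}  {suc j} _   = lookup⁺ Rx j
  allPairs-lookup (Rx ∷ _)   {suc i} {zero}  _   = sym (lookup⁺ Rx i)
  allPairs-lookup (_  ∷ Rxs) {suc i} {suc j} i≢j = allPairs-lookup Rxs (i≢j ∘ cong suc)

-- A missed value j would let punchOut j squeeze f into an injection Fin (1 + n) → Fin n.
injective⇒surjective : ∀ {n} (f : Fin n → Fin n) → Injective _≡_ _≡_ f →
                       ∀ j → ∃ λ i → f i ≡ j
injective⇒surjective {ℕ.suc n} f f-inj j with any? (λ i → f i ≟ j)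
... | yes hit  = hit
... | no  miss = ⊥-elim (<⇒notInjective (n<1+n n) g-inj)
  where
  j≢f : ∀ i → j ≢ f i
  j≢f i j≡fi = miss (i , ≡.sym j≡fi)

  g-inj : Injective _≡_ _≡_ (λ i → punchOut (j≢f i))
  g-inj {x} {y} eq = f-inj (punchOut-injective (j≢f x) (j≢f y) eq)

module Geometry {c ℓ : Level} (K : Field c ℓ) where
  open Field K hiding (zero)
  open CommutativeRingSolver commRing
  open import Algebra.Properties.Group +-group using (x≈y⇒x∙y⁻¹≈ε)
  open import Relation.Binary.Reasoning.Setoid setoid

  ≈0-cancelˡ : ∀ {x y} → ¬ x ≈ 0# → x * y ≈ 0# → y ≈ 0#
  ≈0-cancelˡ {x} {y} x≉0 xy≈0 = begin
    y              ≈⟨ *-identityˡ y ⟨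
    1# * y         ≈⟨ *-congʳ (inv-law x x≉0) ⟨
    x * x⁻¹ * y    ≈⟨ solve 3 (λ x x⁻¹ y → x :* x⁻¹ :* y := x⁻¹ :* (x :* y)) refl x x⁻¹ y ⟩
    x⁻¹ * (x * y)  ≈⟨ *-congˡ xy≈0 ⟩
    x⁻¹ * 0#       ≈⟨ zeroʳ x⁻¹ ⟩
    0#             ∎
    where x⁻¹ = inv x x≉0

  *-≉0 : ∀ {x y} → ¬ x ≈ 0# → ¬ y ≈ 0# → ¬ x * y ≈ 0#
  *-≉0 x≉0 y≉0 = y≉0 ∘ ≈0-cancelˡ x≉0

  zero-factorˡ : ∀ {x} y → x ≈ 0# → x * y ≈ 0#
  zero-factorˡ y x≈0 = trans (*-congʳ x≈0) (zeroˡ y)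

  zero-factorʳ : ∀ x {y} → y ≈ 0# → x * y ≈ 0#
  zero-factorʳ x y≈0 = trans (*-congˡ y≈0) (zeroʳ x)

  factor-≉0 : ∀ {x w y} → x ≈ w * y → ¬ x ≈ 0# → ¬ y ≈ 0#
  factor-≉0 {w = w} x≈wy x≉0 y≈0 = x≉0 (trans x≈wy (zero-factorʳ w y≈0))

  multiple-≉0 : ∀ {x w y} → x ≈ w * y → ¬ w ≈ 0# → ¬ y ≈ 0# → ¬ x ≈ 0#
  multiple-≉0 x≈wy w≉0 y≉0 x≈0 = *-≉0 w≉0 y≉0 (trans (sym x≈wy) x≈0)

  combination₂≈0 : ∀ {t x F y G} → t ≈ x * F + y * G → F ≈ 0# → G ≈ 0# → t ≈ 0#
  combination₂≈0 {x = x} {y = y} t≈ F≈0 G≈0 =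
    trans t≈ (trans (+-cong (zero-factorʳ x F≈0) (zero-factorʳ y G≈0)) (+-identityʳ 0#))

  combination₃≈0 : ∀ {t x F y G z H} → t ≈ x * F + y * G + z * H →
                   F ≈ 0# → G ≈ 0# → H ≈ 0# → t ≈ 0#
  combination₃≈0 t≈ F≈0 G≈0 H≈0 =
    combination₂≈0 (trans t≈ (+-congʳ (sym (*-identityˡ _))))
      (combination₂≈0 refl F≈0 G≈0) H≈0

  combination₄≈0 : ∀ {t x F y G z H w I} → t ≈ x * F + y * G + z * H + w * I →
                   F ≈ 0# → G ≈ 0# → H ≈ 0# → I ≈ 0# → t ≈ 0#
  combination₄≈0 t≈ F≈0 G≈0 H≈0 I≈0 =
    combination₂≈0 (trans t≈ (+-congʳ (sym (*-identityˡ _))))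
      (combination₃≈0 refl F≈0 G≈0 H≈0) I≈0

  ≈-modulo : ∀ {a b k e} → e ≈ 0# → a ≈ b + k * e → a ≈ b
  ≈-modulo {b = b} {k} e≈0 a≈ = trans a≈ (trans (+-congˡ (zero-factorʳ k e≈0)) (+-identityʳ b))

  -- Pairs (s , t) are homogeneous coordinates of points (s : t) of the projective line.
  bracket : Carrier × Carrier → Carrier × Carrier → Carrier
  bracket (s , t) (s′ , t′) = s * t′ - s′ * t

  squared : Carrier × Carrier → Carrier × Carrier
  squared (s , t) = s * s , t * t

  Apart : Rel (Carrier × Carrier) ℓ
  Apart p q = ¬ bracket p q ≈ 0#

  AffinelyApart : Rel Carrier ℓ
  AffinelyApart x y = Apart (x , 1#) (y , 1#)

  private
    :bracket : ∀ {n} → Polynomial n → Polynomial n → Polynomial n → Polynomial n → Polynomial n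
    :bracket s t s′ t′ = s :* t′ :- s′ :* t

    :quadratic : ∀ {n} → Polynomial n → Polynomial n → Polynomial n →
                 Polynomial n → Polynomial n → Polynomial n
    :quadratic a₀ a₁ a₂ s t = a₀ :* (s :* s) :+ a₁ :* (s :* t) :+ a₂ :* (t :* t)

    :conic : ∀ {n} → Polynomial n → Polynomial n → Polynomial n → Polynomial n → Polynomial n →
             Polynomial n → Polynomial n → Polynomial n → Polynomial n → Polynomial n
    :conic a₀ a₁ a₂ a₃ a₄ a₅ x y z =
      a₀ :* (x :* x) :+ a₁ :* (y :* y) :+ a₂ :* (z :* z)
      :+ a₃ :* (x :* y) :+ a₄ :* (x :* z) :+ a₅ :* (y :* z)

    :0 :1 : ∀ {n} → Polynomial n
    :0 = con (0 , 0)
    :1 = con (1 , 0)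

  apart-sym : Symmetric Apart
  apart-sym {s , t} {s′ , t′} = factor-≉0
    (solve 4 (λ s t s′ t′ → :bracket s t s′ t′ := con (0 , 1) :* :bracket s′ t′ s t) refl s t s′ t′)

  apart-squared⇒apart : ∀ {p q} → Apart (squared p) (squared q) → Apart p q
  apart-squared⇒apart {s , t} {s′ , t′} = factor-≉0
    (solve 4 (λ s t s′ t′ → :bracket (s :* s) (t :* t) (s′ :* s′) (t′ :* t′)
                          := (s :* t′ :+ s′ :* t) :* :bracket s t s′ t′)
       refl s t s′ t′)

  apart-affine : ∀ {x y} → ¬ x * x - y * y ≈ 0# → Apart (squared (x , 1#)) (squared (y , 1#))
  apart-affine {x} {y} = factor-≉0
    (solve 2 (λ x y → x :* x :- y :* y := :1 :* :bracket (x :* x) (:1 :* :1) (y :* y) (:1 :* :1))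
       refl x y)

  apart-∞ : ∀ {x} → Apart (squared (x , 1#)) (squared (1# , 0#))
  apart-∞ {x} = factor-≉0
    (solve 1 (λ x → :1 := con (0 , 1) :* :bracket (x :* x) (:1 :* :1) (:1 :* :1) (:0 :* :0))
       refl x)
    1≉0

  linearForm : Carrier → Carrier → Carrier × Carrier → Carrier
  linearForm a b (s , t) = a * s + b * t

  linearForm-vanishing : ∀ {a b} p q → Apart p q →
                         linearForm a b p ≈ 0# → linearForm a b q ≈ 0# → a ≈ 0# × b ≈ 0#
  linearForm-vanishing {a} {b} (s , t) (s′ , t′) p#q Lp≈0 Lq≈0 =
      ≈0-cancelˡ p#q (combination₂≈0
        (solve 6 (λ a b s t s′ t′ → :bracket s t s′ t′ :* a
                                  := t′ :* (a :* s :+ b :* t) :+ (:- t) :* (a :* s′ :+ b :* t′))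
           refl a b s t s′ t′)
        Lp≈0 Lq≈0)
    , ≈0-cancelˡ p#q (combination₂≈0
        (solve 6 (λ a b s t s′ t′ → :bracket s t s′ t′ :* b
                                  := (:- s′) :* (a :* s :+ b :* t) :+ s :* (a :* s′ :+ b :* t′))
           refl a b s t s′ t′)
        Lp≈0 Lq≈0)

  quadraticForm : (Fin 3 → Carrier) → Carrier × Carrier → Carrier
  quadraticForm a (s , t) = a 0F * (s * s) + a 1F * (s * t) + a 2F * (t * t)

  -- Cramer's rule: the Vandermonde determinant of the three points is the product of their brackets.
  quadraticForm-vanishing : ∀ {a} p q r → Apart p q → Apart p r → Apart q r →
                            quadraticForm a p ≈ 0# → quadraticForm a q ≈ 0# → quadraticForm a r ≈ 0# →
                            ∀ m → a m ≈ 0#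
  quadraticForm-vanishing {a} (s₀ , t₀) (s₁ , t₁) (s₂ , t₂) p#q p#r q#r F₀ F₁ F₂ = coefficient
    where
    D≉0 = *-≉0 (*-≉0 p#q p#r) q#r

    coefficient : ∀ m → a m ≈ 0#
    coefficient 0F = ≈0-cancelˡ D≉0 (combination₃≈0
      (solve 9 (λ a₀ a₁ a₂ s₀ t₀ s₁ t₁ s₂ t₂ →
           :bracket s₀ t₀ s₁ t₁ :* :bracket s₀ t₀ s₂ t₂ :* :bracket s₁ t₁ s₂ t₂ :* a₀
        := (t₁ :* t₂ :* :bracket s₁ t₁ s₂ t₂) :* :quadratic a₀ a₁ a₂ s₀ t₀
        :+ (:- (t₀ :* t₂ :* :bracket s₀ t₀ s₂ t₂)) :* :quadratic a₀ a₁ a₂ s₁ t₁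
        :+ (t₀ :* t₁ :* :bracket s₀ t₀ s₁ t₁) :* :quadratic a₀ a₁ a₂ s₂ t₂)
        refl (a 0F) (a 1F) (a 2F) s₀ t₀ s₁ t₁ s₂ t₂)
      F₀ F₁ F₂)
    coefficient 1F = ≈0-cancelˡ D≉0 (combination₃≈0
      (solve 9 (λ a₀ a₁ a₂ s₀ t₀ s₁ t₁ s₂ t₂ →
           :bracket s₀ t₀ s₁ t₁ :* :bracket s₀ t₀ s₂ t₂ :* :bracket s₁ t₁ s₂ t₂ :* a₁
        := (:- (:bracket s₁ t₁ s₂ t₂ :* (s₁ :* t₂ :+ s₂ :* t₁))) :* :quadratic a₀ a₁ a₂ s₀ t₀
        :+ (:bracket s₀ t₀ s₂ t₂ :* (s₀ :* t₂ :+ s₂ :* t₀)) :* :quadratic a₀ a₁ a₂ s₁ t₁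
        :+ (:- (:bracket s₀ t₀ s₁ t₁ :* (s₀ :* t₁ :+ s₁ :* t₀))) :* :quadratic a₀ a₁ a₂ s₂ t₂)
        refl (a 0F) (a 1F) (a 2F) s₀ t₀ s₁ t₁ s₂ t₂)
      F₀ F₁ F₂)
    coefficient 2F = ≈0-cancelˡ D≉0 (combination₃≈0
      (solve 9 (λ a₀ a₁ a₂ s₀ t₀ s₁ t₁ s₂ t₂ →
           :bracket s₀ t₀ s₁ t₁ :* :bracket s₀ t₀ s₂ t₂ :* :bracket s₁ t₁ s₂ t₂ :* a₂
        := (s₁ :* s₂ :* :bracket s₁ t₁ s₂ t₂) :* :quadratic a₀ a₁ a₂ s₀ t₀
        :+ (:- (s₀ :* s₂ :* :bracket s₀ t₀ s₂ t₂)) :* :quadratic a₀ a₁ a₂ s₁ t₁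
        :+ (s₀ :* s₁ :* :bracket s₀ t₀ s₁ t₁) :* :quadratic a₀ a₁ a₂ s₂ t₂)
        refl (a 0F) (a 1F) (a 2F) s₀ t₀ s₁ t₁ s₂ t₂)
      F₀ F₁ F₂)

  cubic : Carrier → Carrier → Carrier → Carrier → Carrier → Carrier
  cubic c₀ c₁ c₂ c₃ x = c₀ + c₁ * x + c₂ * (x * x) + c₃ * (x * (x * x))

  -- Dividing by x - x₀ leaves a quadratic vanishing at the three other points.
  cubic-vanishing : ∀ {c₀ c₁ c₂ c₃} x₀ x₁ x₂ x₃ →
                    AllPairs AffinelyApart (x₀ ∷ x₁ ∷ x₂ ∷ x₃ ∷ []) →
                    All (λ x → cubic c₀ c₁ c₂ c₃ x ≈ 0#) (x₀ ∷ x₁ ∷ x₂ ∷ x₃ ∷ []) →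
                    All (_≈ 0#) (c₀ ∷ c₁ ∷ c₂ ∷ c₃ ∷ [])
  cubic-vanishing {c₀} {c₁} {c₂} {c₃} x₀ x₁ x₂ x₃
    ((x₀#x₁ ∷ x₀#x₂ ∷ x₀#x₃ ∷ []) ∷ (x₁#x₂ ∷ x₁#x₃ ∷ []) ∷ (x₂#x₃ ∷ []) ∷ [] ∷ [])
    (g₀ ∷ g₁ ∷ g₂ ∷ g₃ ∷ []) = c₀≈0 ∷ c₁≈0 ∷ c₂≈0 ∷ c₃≈0 ∷ []
    where
    quotient : Fin 3 → Carrier
    quotient 0F = c₃
    quotient 1F = c₃ * x₀ + c₂
    quotient 2F = c₃ * (x₀ * x₀) + c₂ * x₀ + c₁

    quotient-root : ∀ {x} → AffinelyApart x₀ x → cubic c₀ c₁ c₂ c₃ x ≈ 0# →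
                    quadraticForm quotient (x , 1#) ≈ 0#
    quotient-root {x} x₀#x gx = ≈0-cancelˡ x₀#x (combination₂≈0
      (solve 6 (λ c₀ c₁ c₂ c₃ x₀ x →
           :bracket x₀ :1 x :1
             :* :quadratic c₃ (c₃ :* x₀ :+ c₂) (c₃ :* (x₀ :* x₀) :+ c₂ :* x₀ :+ c₁) x :1
        := :1 :* (c₀ :+ c₁ :* x₀ :+ c₂ :* (x₀ :* x₀) :+ c₃ :* (x₀ :* (x₀ :* x₀)))
        :+ con (0 , 1) :* (c₀ :+ c₁ :* x :+ c₂ :* (x :* x) :+ c₃ :* (x :* (x :* x))))
        refl c₀ c₁ c₂ c₃ x₀ x)
      g₀ gx)

    quotient≈0 : ∀ m → quotient m ≈ 0#
    quotient≈0 = quadraticForm-vanishing (x₁ , 1#) (x₂ , 1#) (x₃ , 1#) x₁#x₂ x₁#x₃ x₂#x₃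
      (quotient-root x₀#x₁ g₁) (quotient-root x₀#x₂ g₂) (quotient-root x₀#x₃ g₃)

    c₃≈0 : c₃ ≈ 0#
    c₃≈0 = quotient≈0 0F

    c₂≈0 : c₂ ≈ 0#
    c₂≈0 = combination₂≈0
      (solve 3 (λ c₂ c₃ x₀ → c₂ := :1 :* (c₃ :* x₀ :+ c₂) :+ (:- x₀) :* c₃) refl c₂ c₃ x₀)
      (quotient≈0 1F) c₃≈0

    c₁≈0 : c₁ ≈ 0#
    c₁≈0 = combination₃≈0
      (solve 4 (λ c₁ c₂ c₃ x₀ → c₁ := :1 :* (c₃ :* (x₀ :* x₀) :+ c₂ :* x₀ :+ c₁)
                                    :+ (:- (x₀ :* x₀)) :* c₃ :+ (:- x₀) :* c₂)
        refl c₁ c₂ c₃ x₀)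
      (quotient≈0 2F) c₃≈0 c₂≈0

    c₀≈0 : c₀ ≈ 0#
    c₀≈0 = combination₄≈0
      (solve 5 (λ c₀ c₁ c₂ c₃ x₀ →
           c₀ := :1 :* (c₀ :+ c₁ :* x₀ :+ c₂ :* (x₀ :* x₀) :+ c₃ :* (x₀ :* (x₀ :* x₀)))
              :+ (:- x₀) :* c₁ :+ (:- (x₀ :* x₀)) :* c₂ :+ (:- (x₀ :* (x₀ :* x₀))) :* c₃)
        refl c₀ c₁ c₂ c₃ x₀)
      g₀ c₁≈0 c₂≈0 c₃≈0

  record IsConicPoint (p : Carrier × Carrier) (P : P2 K) : Set ℓ where
    constructor conicPoint
    field
      x≈ : px P ≈ proj₁ p * proj₁ p
      y≈ : py P ≈ proj₁ p * proj₂ p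
      z≈ : pz P ≈ proj₂ p * proj₂ p

  record IsPole (P : P2 K) : Set ℓ where
    constructor pole
    field
      x≈0 : px P ≈ 0#
      y≈1 : py P ≈ 1#
      z≈0 : pz P ≈ 0#

  Collinear : P2 K → P2 K → P2 K → Set (c ⊔ ℓ)
  Collinear P Q R = Σ (Fin 3 → Carrier) λ a →
    NonZeroCoeffs K a × evalLine K a P ≈ 0# × evalLine K a Q ≈ 0# × evalLine K a R ≈ 0#

  evalLine-conicPoint : ∀ {p P} a → IsConicPoint p P → evalLine K a P ≈ quadraticForm a p
  evalLine-conicPoint a (conicPoint x≈ y≈ z≈) = +-cong (+-cong (*-congˡ x≈) (*-congˡ y≈)) (*-congˡ z≈)

  evalLine-pole : ∀ {P} a → IsPole P → evalLine K a P ≈ a 1F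
  evalLine-pole a (pole x≈ y≈ z≈) = trans (+-cong (+-cong (*-congˡ x≈) (*-congˡ y≈)) (*-congˡ z≈))
    (solve 3 (λ a₀ a₁ a₂ → a₀ :* :0 :+ a₁ :* :1 :+ a₂ :* :0 := a₁)
       refl (a 0F) (a 1F) (a 2F))

  conicForm : (Fin 6 → Carrier) → Carrier → Carrier → Carrier → Carrier
  conicForm a x y z =
    a 0F * (x * x) + a 1F * (y * y) + a 2F * (z * z) + a 3F * (x * y) + a 4F * (x * z) + a 5F * (y * z)

  evalConic-cong : ∀ {P x y z} a → px P ≈ x → py P ≈ y → pz P ≈ z →
                   evalConic K a P ≈ conicForm a x y z
  evalConic-cong a x≈ y≈ z≈ =
    +-cong (+-cong (+-cong (+-cong (+-cong (*-congˡ (*-cong x≈ x≈)) (*-congˡ (*-cong y≈ y≈)))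
                                   (*-congˡ (*-cong z≈ z≈)))
                           (*-congˡ (*-cong x≈ y≈)))
                   (*-congˡ (*-cong x≈ z≈)))
           (*-congˡ (*-cong y≈ z≈))

  evalConic-conicPoint : ∀ {s t P} a → IsConicPoint (s , t) P →
                         evalConic K a P ≈ conicForm a (s * s) (s * t) (t * t)
  evalConic-conicPoint {P = P} a (conicPoint x≈ y≈ z≈) = evalConic-cong {P} a x≈ y≈ z≈

  evalConic-pole : ∀ {P} a → IsPole P → evalConic K a P ≈ a 1F
  evalConic-pole {P} a (pole x≈ y≈ z≈) = trans (evalConic-cong {P} a x≈ y≈ z≈)
    (solve 6 (λ a₀ a₁ a₂ a₃ a₄ a₅ → :conic a₀ a₁ a₂ a₃ a₄ a₅ :0 :1 :0 := a₁)
       refl (a 0F) (a 1F) (a 2F) (a 3F) (a 4F) (a 5F))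

  samePoint-sym : ∀ {P Q} → SamePoint K P Q → SamePoint K Q P
  samePoint-sym (t , t≉0 , x≈ , y≈ , z≈) = t⁻¹ , t⁻¹≉0 , unscale x≈ , unscale y≈ , unscale z≈
    where
    t⁻¹ = inv t t≉0

    t⁻¹≉0 : ¬ t⁻¹ ≈ 0#
    t⁻¹≉0 t⁻¹≈0 = 1≉0 (trans (sym (inv-law t t≉0)) (zero-factorʳ t t⁻¹≈0))

    unscale : ∀ {x y} → x ≈ t * y → y ≈ t⁻¹ * x
    unscale {x} {y} x≈ty = begin
      y              ≈⟨ *-identityˡ y ⟨
      1# * y         ≈⟨ *-congʳ (inv-law t t≉0) ⟨
      t * t⁻¹ * y    ≈⟨ solve 3 (λ t t⁻¹ y → t :* t⁻¹ :* y := t⁻¹ :* (t :* y)) refl t t⁻¹ y ⟩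
      t⁻¹ * (t * y)  ≈⟨ *-congˡ x≈ty ⟨
      t⁻¹ * x        ∎

  -- The scale λ would satisfy λ² = (py P)² = px P · pz P = 0.
  conicPoint-≁-pole : ∀ {p P Q} → IsConicPoint p P → IsPole Q → ¬ SamePoint K P Q
  conicPoint-≁-pole {s , t} {P} {Q} (conicPoint Px Py Pz) (pole Qx Qy _) (λ′ , λ≉0 , x≈ , y≈ , z≈) =
    *-≉0 λ≉0 λ≉0 (begin
      λ′ * λ′                    ≈⟨ solve 1 (λ l → l :* l := (l :* :1) :* (l :* :1)) refl λ′ ⟩
      (λ′ * 1#) * (λ′ * 1#)      ≈⟨ *-cong λ≈pyP λ≈pyP ⟩
      py P * py P                ≈⟨ *-cong Py Py ⟩
      (s * t) * (s * t)          ≈⟨ solve 2 (λ s t → (s :* t) :* (s :* t) := (s :* s) :* (t :* t)) refl s t ⟩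
      (s * s) * (t * t)          ≈⟨ *-cong (trans (sym Px) x≈) (trans (sym Pz) z≈) ⟩
      (λ′ * px Q) * (λ′ * pz Q)  ≈⟨ zero-factorˡ _ (zero-factorʳ λ′ Qx) ⟩
      0#                         ∎)
    where
    λ≈pyP : λ′ * 1# ≈ py P
    λ≈pyP = trans (*-congˡ (sym Qy)) (sym y≈)

  -- Squared, because the bracket itself can only be recovered after deciding which of s′, t′ is nonzero.
  samePoint⇒bracket²≈0 : ∀ {p q P Q} → IsConicPoint p P → IsConicPoint q Q → SamePoint K P Q →
                         bracket p q * bracket p q ≈ 0#
  samePoint⇒bracket²≈0 {s , t} {s′ , t′} (conicPoint Px Py Pz) (conicPoint Qx Qy Qz)
                       (λ′ , _ , x≈ , y≈ , z≈) =
    combination₃≈0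
      (solve 5 (λ s t s′ t′ l → :bracket s t s′ t′ :* :bracket s t s′ t′
                              := (t′ :* t′) :* (s :* s :- l :* (s′ :* s′))
                              :+ (:- (s′ :* t′ :+ s′ :* t′)) :* (s :* t :- l :* (s′ :* t′))
                              :+ (s′ :* s′) :* (t :* t :- l :* (t′ :* t′)))
         refl s t s′ t′ λ′)
      (scaled Px x≈ Qx) (scaled Py y≈ Qy) (scaled Pz z≈ Qz)
    where
    scaled : ∀ {P Q x y} → P ≈ x → P ≈ λ′ * Q → Q ≈ y → x - λ′ * y ≈ 0#
    scaled P≈x P≈λQ Q≈y = x≈y⇒x∙y⁻¹≈ε (trans (sym P≈x) (trans P≈λQ (*-congˡ Q≈y)))

  line-through-conicPoints : ∀ {a p q r P Q R} → Apart p q → Apart p r → Apart q r →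
                             IsConicPoint p P → IsConicPoint q Q → IsConicPoint r R →
                             evalLine K a P ≈ 0# → evalLine K a Q ≈ 0# → evalLine K a R ≈ 0# →
                             ∀ m → a m ≈ 0#
  line-through-conicPoints {a} {p} {q} {r} p#q p#r q#r cP cQ cR aP aQ aR =
    quadraticForm-vanishing p q r p#q p#r q#r (restrict cP aP) (restrict cQ aQ) (restrict cR aR)
    where
    restrict : ∀ {o O} → IsConicPoint o O → evalLine K a O ≈ 0# → quadraticForm a o ≈ 0#
    restrict cO aO = trans (sym (evalLine-conicPoint a cO)) aO

  -- A line through the pole has no y-term, so on the conic it is a linear form in (s² : t²).
  line-through-conicPoints-and-pole : ∀ {a p q P Q R} → Apart (squared p) (squared q) →
                                      IsConicPoint p P → IsConicPoint q Q → IsPole R →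
                                      evalLine K a P ≈ 0# → evalLine K a Q ≈ 0# → evalLine K a R ≈ 0# →
                                      ∀ m → a m ≈ 0#
  line-through-conicPoints-and-pole {a} {p} {q} p²#q² cP cQ pR aP aQ aR = coefficient
    where
    a₁≈0 : a 1F ≈ 0#
    a₁≈0 = trans (sym (evalLine-pole a pR)) aR

    restrict : ∀ {o O} → IsConicPoint o O → evalLine K a O ≈ 0# →
               linearForm (a 0F) (a 2F) (squared o) ≈ 0#
    restrict {s , t} cO aO = combination₂≈0
      (solve 5 (λ a₀ a₁ a₂ s t → a₀ :* (s :* s) :+ a₂ :* (t :* t)
                              := :1 :* :quadratic a₀ a₁ a₂ s t :+ (:- (s :* t)) :* a₁)
         refl (a 0F) (a 1F) (a 2F) s t)
      (trans (sym (evalLine-conicPoint a cO)) aO) a₁≈0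

    a₀,a₂≈0 : a 0F ≈ 0# × a 2F ≈ 0#
    a₀,a₂≈0 = linearForm-vanishing (squared p) (squared q) p²#q² (restrict cP aP) (restrict cQ aQ)

    coefficient : ∀ m → a m ≈ 0#
    coefficient 0F = proj₁ a₀,a₂≈0
    coefficient 1F = a₁≈0
    coefficient 2F = proj₂ a₀,a₂≈0

  -- Conversely the line x = p² z passes through the pole and every conic point with parameter ±p.
  collinear-with-pole : ∀ {p q P Q R} → IsConicPoint (p , 1#) P → IsConicPoint (q , 1#) Q → IsPole R →
                        p * p - q * q ≈ 0# → Collinear P Q R
  collinear-with-pole {p} {q} cP cQ pR p²≈q² =
      line , (λ line≈0 → 1≉0 (line≈0 0F))
    , trans (evalLine-conicPoint line cP)
        (solve 1 (λ p → :quadratic :1 (:0) (:- (p :* p)) p :1 := :0) refl p)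
    , trans (evalLine-conicPoint line cQ)
        (trans (solve 2 (λ p q → :quadratic :1 (:0) (:- (p :* p)) q :1
                               := con (0 , 1) :* (p :* p :- q :* q))
                  refl p q)
               (zero-factorʳ _ p²≈q²))
    , evalLine-pole line pR
    where
    line : Fin 3 → Carrier
    line 0F = 1#
    line 1F = 0#
    line 2F = - (p * p)

  choose : ∀ {m n} {is : Vec (Fin n) m} → Unique is → Choose K m n
  choose {is = is} is-unique = lookup is , λ {i} {j} → lookup-injective is-unique i j

  noLine⇒¬collinear : ∀ {n} {P : Fin n → P2 K} → GeneralPosition K P →
                      ∀ {i j k} → Unique (i ∷ j ∷ k ∷ []) → ¬ Collinear (P i) (P j) (P k)
  noLine⇒¬collinear {P = P} gp {i} {j} {k} ijk-unique (a , a≢0 , Pi , Pj , Pk) =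
    GeneralPosition.noLine gp (choose ijk-unique) (a , a≢0 , on)
    where
    on : ∀ m → evalLine K a (P (lookup (i ∷ j ∷ k ∷ []) m)) ≈ 0#
    on 0F = Pi
    on 1F = Pj
    on 2F = Pk

  SquaresDistinct : ∀ {n} → Vec Carrier n → Set (c ⊔ ℓ)
  SquaresDistinct = AllPairs (λ x y → ¬ x * x - y * y ≈ 0#)

  -- The fifth parameter (1 : 0) is the point at infinity (1 : 0 : 0) of the conic.
  parameters : Carrier → Carrier → Carrier → Carrier → Vec (Carrier × Carrier) 5
  parameters r₀ r₁ r₂ r₃ = (r₀ , 1#) ∷ (r₁ , 1#) ∷ (r₂ , 1#) ∷ (r₃ , 1#) ∷ (1# , 0#) ∷ []

  parameters-apart : ∀ {r₀ r₁ r₂ r₃} → SquaresDistinct (r₀ ∷ r₁ ∷ r₂ ∷ r₃ ∷ []) →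
                     AllPairs (λ p q → Apart (squared p) (squared q)) (parameters r₀ r₁ r₂ r₃)
  parameters-apart ((d₀₁ ∷ d₀₂ ∷ d₀₃ ∷ []) ∷ (d₁₂ ∷ d₁₃ ∷ []) ∷ (d₂₃ ∷ []) ∷ [] ∷ []) =
      (apart-affine d₀₁ ∷ apart-affine d₀₂ ∷ apart-affine d₀₃ ∷ apart-∞ ∷ [])
    ∷ (apart-affine d₁₂ ∷ apart-affine d₁₃ ∷ apart-∞ ∷ [])
    ∷ (apart-affine d₂₃ ∷ apart-∞ ∷ [])
    ∷ (apart-∞ ∷ [])
    ∷ []
    ∷ []

  conicPair-unique : ∀ {i j : Fin 5} → i ≢ j → Unique (inject₁ i ∷ inject₁ j ∷ fromℕ 5 ∷ [])
  conicPair-unique i≢j =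
      ((i≢j ∘ inject₁-injective) ∷ (fromℕ≢inject₁ ∘ ≡.sym) ∷ [])
    ∷ ((fromℕ≢inject₁ ∘ ≡.sym) ∷ [])
    ∷ []
    ∷ []

  module SixPoints (r₀ r₁ r₂ r₃ : Carrier) (P : Fin 6 → P2 K)
                   (onConic : ∀ k → IsConicPoint (lookup (parameters r₀ r₁ r₂ r₃) k) (P (inject₁ k)))
                   (atPole : IsPole (P (fromℕ 5)))
                   where

    squaresDistinct : GeneralPosition K P → SquaresDistinct (r₀ ∷ r₁ ∷ r₂ ∷ r₃ ∷ [])
    squaresDistinct gp =
        ( squares-differ 0F 1F (λ ()) (onConic 0F) (onConic 1F)
        ∷ squares-differ 0F 2F (λ ()) (onConic 0F) (onConic 2F)
        ∷ squares-differ 0F 3F (λ ()) (onConic 0F) (onConic 3F) ∷ [])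
      ∷ ( squares-differ 1F 2F (λ ()) (onConic 1F) (onConic 2F)
        ∷ squares-differ 1F 3F (λ ()) (onConic 1F) (onConic 3F) ∷ [])
      ∷ (squares-differ 2F 3F (λ ()) (onConic 2F) (onConic 3F) ∷ [])
      ∷ []
      ∷ []
      where
      squares-differ : ∀ {p q} (i j : Fin 5) → i ≢ j →
                       IsConicPoint (p , 1#) (P (inject₁ i)) → IsConicPoint (q , 1#) (P (inject₁ j)) →
                       ¬ p * p - q * q ≈ 0#
      squares-differ i j i≢j cP cQ =
        noLine⇒¬collinear gp (conicPair-unique i≢j) ∘ collinear-with-pole cP cQ atPole

    module _ (distinctSquares : SquaresDistinct (r₀ ∷ r₁ ∷ r₂ ∷ r₃ ∷ [])) where

      squares-apart : ∀ {k l} → k ≢ l → Apart (squared (lookup (parameters r₀ r₁ r₂ r₃) k))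
                                                (squared (lookup (parameters r₀ r₁ r₂ r₃) l))
      squares-apart = allPairs-lookup apart-sym (parameters-apart distinctSquares)

      apart : ∀ {k l} → inject₁ k ≢ inject₁ l →
              Apart (lookup (parameters r₀ r₁ r₂ r₃) k) (lookup (parameters r₀ r₁ r₂ r₃) l)
      apart k≢l = apart-squared⇒apart (squares-apart (k≢l ∘ cong inject₁))

      points-distinct : ∀ {i j} → View i → View j → i ≢ j → ¬ SamePoint K (P i) (P j)
      points-distinct (‵inject₁ k) (‵inject₁ l) i≢j same =
        *-≉0 (apart i≢j) (apart i≢j) (samePoint⇒bracket²≈0 (onConic k) (onConic l) same)
      points-distinct (‵inject₁ k) ‵fromℕ _ =
        conicPoint-≁-pole (onConic k) atPole
      points-distinct ‵fromℕ (‵inject₁ l) _ same =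
        conicPoint-≁-pole (onConic l) atPole (samePoint-sym {P (fromℕ 5)} {P (inject₁ l)} same)
      points-distinct ‵fromℕ ‵fromℕ i≢j = contradiction ≡.refl i≢j

      line-vanishing : ∀ {a i j k} → View i → View j → View k → i ≢ j → i ≢ k → j ≢ k →
                       evalLine K a (P i) ≈ 0# → evalLine K a (P j) ≈ 0# → evalLine K a (P k) ≈ 0# →
                       ∀ m → a m ≈ 0#
      line-vanishing ‵fromℕ ‵fromℕ _      i≢j _   _   = contradiction ≡.refl i≢j
      line-vanishing ‵fromℕ _      ‵fromℕ _   i≢k _   = contradiction ≡.refl i≢k
      line-vanishing _      ‵fromℕ ‵fromℕ _   _   j≢k = contradiction ≡.refl j≢k
      line-vanishing (‵inject₁ k) (‵inject₁ l) (‵inject₁ m) i≢j i≢k j≢k =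
        line-through-conicPoints (apart i≢j) (apart i≢k) (apart j≢k) (onConic k) (onConic l) (onConic m)
      line-vanishing (‵inject₁ k) (‵inject₁ l) ‵fromℕ i≢j _ _ =
        line-through-conicPoints-and-pole (squares-apart (i≢j ∘ cong inject₁))
          (onConic k) (onConic l) atPole
      line-vanishing (‵inject₁ k) ‵fromℕ (‵inject₁ m) _ i≢k _ Pi Pj Pk =
        line-through-conicPoints-and-pole (squares-apart (i≢k ∘ cong inject₁))
          (onConic k) (onConic m) atPole Pi Pk Pj
      line-vanishing ‵fromℕ (‵inject₁ l) (‵inject₁ m) _ _ j≢k Pi Pj Pk =
        line-through-conicPoints-and-pole (squares-apart (j≢k ∘ cong inject₁))
          (onConic l) (onConic m) atPole Pj Pk Pi

      conic-vanishing : ∀ {a} → (∀ j → evalConic K a (P j) ≈ 0#) → ∀ m → a m ≈ 0#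
      conic-vanishing {a} on = coefficient
        where
        a₀≈0 : a 0F ≈ 0#
        a₀≈0 = trans (sym (trans (evalConic-conicPoint a (onConic 4F))
                 (solve 6 (λ a₀ a₁ a₂ a₃ a₄ a₅ →
                    :conic a₀ a₁ a₂ a₃ a₄ a₅ (:1 :* :1) (:1 :* :0) (:0 :* :0) := a₀)
                    refl (a 0F) (a 1F) (a 2F) (a 3F) (a 4F) (a 5F))))
               (on 4F)

        a₁≈0 : a 1F ≈ 0#
        a₁≈0 = trans (sym (evalConic-pole a atPole)) (on 5F)

        on-affine : ∀ {x Q} → IsConicPoint (x , 1#) Q → evalConic K a Q ≈ 0# →
                    cubic (a 2F) (a 5F) (a 4F) (a 3F) x ≈ 0#
        on-affine {x} cQ aQ = combination₃≈0
          (solve 7 (λ a₀ a₁ a₂ a₃ a₄ a₅ x →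
               a₂ :+ a₅ :* x :+ a₄ :* (x :* x) :+ a₃ :* (x :* (x :* x))
            := :1 :* :conic a₀ a₁ a₂ a₃ a₄ a₅ (x :* x) (x :* :1) (:1 :* :1)
               :+ (:- ((x :* x) :* (x :* x))) :* a₀ :+ (:- (x :* x)) :* a₁)
             refl (a 0F) (a 1F) (a 2F) (a 3F) (a 4F) (a 5F) x)
          (trans (sym (evalConic-conicPoint a cQ)) aQ) a₀≈0 a₁≈0

        cubic≈0 : All (_≈ 0#) (a 2F ∷ a 5F ∷ a 4F ∷ a 3F ∷ [])
        cubic≈0 = cubic-vanishing r₀ r₁ r₂ r₃
          (AllPairs.map (apart-squared⇒apart ∘ apart-affine) distinctSquares)
          ( on-affine (onConic 0F) (on 0F) ∷ on-affine (onConic 1F) (on 1F)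
          ∷ on-affine (onConic 2F) (on 2F) ∷ on-affine (onConic 3F) (on 3F) ∷ [])

        coefficient : ∀ m → a m ≈ 0#
        coefficient 0F = a₀≈0
        coefficient 1F = a₁≈0
        coefficient 2F = lookup⁺ cubic≈0 0F
        coefficient 3F = lookup⁺ cubic≈0 3F
        coefficient 4F = lookup⁺ cubic≈0 2F
        coefficient 5F = lookup⁺ cubic≈0 1F

      noLine : (s : Choose K 3 6) →
               ¬ (Σ (Fin 3 → Carrier) λ a →
                    NonZeroCoeffs K a × (∀ i → evalLine K a (P (proj₁ s i)) ≈ 0#))
      noLine (s , s-inj) (a , a≢0 , on) =
        a≢0 (line-vanishing (view (s 0F)) (view (s 1F)) (view (s 2F))
               (separate (λ ())) (separate (λ ())) (separate (λ ())) (on 0F) (on 1F) (on 2F))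
        where
        separate : ∀ {x y} → x ≢ y → s x ≢ s y
        separate x≢y = x≢y ∘ s-inj

      noConic : (s : Choose K 6 6) →
                ¬ (Σ (Fin 6 → Carrier) λ a →
                     NonZeroCoeffs K a × (∀ i → evalConic K a (P (proj₁ s i)) ≈ 0#))
      noConic (s , s-inj) (a , a≢0 , on) = a≢0 (conic-vanishing on-all)
        where
        on-all : ∀ j → evalConic K a (P j) ≈ 0#
        on-all j with injective⇒surjective s s-inj j
        ... | i , ≡.refl = on i

      generalPosition : GeneralPosition K P
      generalPosition = record
        { distinct  = λ i j → points-distinct (view i) (view j)
        ; noLine    = noLine
        ; noConic   = noConic
        ; noSingCub = λ (_ , s-inj) _ → <⇒notInjective (<-trans (n<1+n 6) (n<1+n 7)) s-inj
        }

    generalPosition⇔squaresDistinct : GeneralPosition K P ⇔ SquaresDistinct (r₀ ∷ r₁ ∷ r₂ ∷ r₃ ∷ [])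
    generalPosition⇔squaresDistinct = mk⇔ squaresDistinct generalPosition

  x⁴-1≈x²[x²-x′²] : ∀ {x x′} → x * x′ ≈ 1# → x * x * x * x - 1# ≈ (x * x) * (x * x - x′ * x′)
  x⁴-1≈x²[x²-x′²] {x} {x′} xx′≈1 = ≈-modulo (x≈y⇒x∙y⁻¹≈ε xx′≈1)
    (solve 2 (λ x x′ → x :* x :* x :* x :- :1
                     := (x :* x) :* (x :* x :- x′ :* x′) :+ (x :* x′ :+ :1) :* (x :* x′ :- :1))
       refl x x′)

  x²y²-1≈y²[x²-y′²] : ∀ {x y y′} → y * y′ ≈ 1# → x * x * (y * y) - 1# ≈ (y * y) * (x * x - y′ * y′)
  x²y²-1≈y²[x²-y′²] {x} {y} {y′} yy′≈1 = ≈-modulo (x≈y⇒x∙y⁻¹≈ε yy′≈1)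
    (solve 3 (λ x y y′ → x :* x :* (y :* y) :- :1
                       := (y :* y) :* (x :* x :- y′ :* y′) :+ (y :* y′ :+ :1) :* (y :* y′ :- :1))
       refl x y y′)

  x²y²-1≈-x²[x′²-y²] : ∀ {x x′ y} → x * x′ ≈ 1# →
                       x * x * (y * y) - 1# ≈ - (x * x) * (x′ * x′ - y * y)
  x²y²-1≈-x²[x′²-y²] {x} {x′} {y} xx′≈1 = ≈-modulo (x≈y⇒x∙y⁻¹≈ε xx′≈1)
    (solve 3 (λ x x′ y → x :* x :* (y :* y) :- :1
                       := :- (x :* x) :* (x′ :* x′ :- y :* y) :+ (x :* x′ :+ :1) :* (x :* x′ :- :1))
       refl x x′ y)

  x²-y²≈-x²y²[x′²-y′²] : ∀ {x x′ y y′} → x * x′ ≈ 1# → y * y′ ≈ 1# →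
                         x * x - y * y ≈ - (x * x * (y * y)) * (x′ * x′ - y′ * y′)
  x²-y²≈-x²y²[x′²-y′²] {x} {x′} {y} {y′} xx′≈1 yy′≈1 =
    ≈-modulo (x≈y⇒x∙y⁻¹≈ε xx′≈1) (≈-modulo (x≈y⇒x∙y⁻¹≈ε yy′≈1)
      (solve 4 (λ x x′ y y′ → x :* x :- y :* y
                            := :- (x :* x :* (y :* y)) :* (x′ :* x′ :- y′ :* y′)
                               :+ (y :* y :* (x :* x′ :+ :1)) :* (x :* x′ :- :1)
                               :+ (:- (x :* x :* (y :* y′ :+ :1))) :* (y :* y′ :- :1))
         refl x x′ y y′))

  module _ (u v : Carrier) (u≉0 : ¬ u ≈ 0#) (v≉0 : ¬ v ≈ 0#) where
    private
      u⁻¹ = inv u u≉0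
      v⁻¹ = inv v v≉0

    T-onConic : ∀ k → IsConicPoint (lookup (parameters u u⁻¹ v v⁻¹) k) (T K u v u≉0 v≉0 (inject₁ k))
    T-onConic 0F = conicPoint refl (sym (*-identityʳ u))   (sym (*-identityʳ 1#))
    T-onConic 1F = conicPoint refl (sym (*-identityʳ u⁻¹)) (sym (*-identityʳ 1#))
    T-onConic 2F = conicPoint refl (sym (*-identityʳ v))   (sym (*-identityʳ 1#))
    T-onConic 3F = conicPoint refl (sym (*-identityʳ v⁻¹)) (sym (*-identityʳ 1#))
    T-onConic 4F = conicPoint (sym (*-identityʳ 1#)) (sym (zeroʳ 1#)) (sym (zeroʳ 0#))

    T-pole : IsPole (T K u v u≉0 v≉0 (fromℕ 5))
    T-pole = pole refl refl refl

    f≉0⇔squaresDistinct : (¬ f K u v ≈ 0#) ⇔ SquaresDistinct (u ∷ u⁻¹ ∷ v ∷ v⁻¹ ∷ [])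
    f≉0⇔squaresDistinct = mk⇔ to from
      where
      uu⁻¹≈1 = inv-law u u≉0
      vv⁻¹≈1 = inv-law v v≉0

      to : ¬ f K u v ≈ 0# → SquaresDistinct (u ∷ u⁻¹ ∷ v ∷ v⁻¹ ∷ [])
      to f≉0 =
          ( factor-≉0 (x⁴-1≈x²[x²-x′²] uu⁻¹≈1) u⁴≉1
          ∷ u²≉v²
          ∷ factor-≉0 (x²y²-1≈y²[x²-y′²] vv⁻¹≈1) u²v²≉1 ∷ [])
        ∷ ( factor-≉0 (x²y²-1≈-x²[x′²-y²] uu⁻¹≈1) u²v²≉1
          ∷ factor-≉0 (x²-y²≈-x²y²[x′²-y′²] uu⁻¹≈1 vv⁻¹≈1) u²≉v² ∷ [])
        ∷ (factor-≉0 (x⁴-1≈x²[x²-x′²] vv⁻¹≈1) v⁴≉1 ∷ [])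
        ∷ []
        ∷ []
        where
        u⁴≉1 = λ e → f≉0 (zero-factorˡ _ (zero-factorˡ _ (zero-factorˡ _ e)))
        v⁴≉1 = λ e → f≉0 (zero-factorˡ _ (zero-factorˡ _ (zero-factorʳ _ e)))
        u²≉v² = λ e → f≉0 (zero-factorˡ _ (zero-factorʳ _ e))
        u²v²≉1 = λ e → f≉0 (zero-factorʳ _ e)

      from : SquaresDistinct (u ∷ u⁻¹ ∷ v ∷ v⁻¹ ∷ []) → ¬ f K u v ≈ 0#
      from ((u²≉u⁻² ∷ u²≉v² ∷ u²≉v⁻² ∷ []) ∷ _ ∷ (v²≉v⁻² ∷ []) ∷ [] ∷ []) =
        *-≉0 (*-≉0 (*-≉0 (multiple-≉0 (x⁴-1≈x²[x²-x′²] uu⁻¹≈1) u²≉0 u²≉u⁻²)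
                         (multiple-≉0 (x⁴-1≈x²[x²-x′²] vv⁻¹≈1) v²≉0 v²≉v⁻²))
                   u²≉v²)
             (multiple-≉0 (x²y²-1≈y²[x²-y′²] vv⁻¹≈1) v²≉0 u²≉v⁻²)
        where
        u²≉0 = *-≉0 u≉0 u≉0
        v²≉0 = *-≉0 v≉0 v≉0

lemma3p1 : {c ℓ : Level} (K : Field c ℓ) (u v : Field.Carrier K)
           (u≉0 : ¬ (Field._≈_ K u (Field.0# K)))
           (v≉0 : ¬ (Field._≈_ K v (Field.0# K))) →
           GeneralPosition K (T K u v u≉0 v≉0)
             ⇔ (¬ (Field._≈_ K (f K u v) (Field.0# K)))
lemma3p1 K u v u≉0 v≉0 = ⇔.trans
  (SixPoints.generalPosition⇔squaresDistinct u (inv u u≉0) v (inv v v≉0)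
     (T K u v u≉0 v≉0) (T-onConic u v u≉0 v≉0) (T-pole u v u≉0 v≉0))
  (⇔.sym (f≉0⇔squaresDistinct u v u≉0 v≉0))
  where
  open Geometry K
  open Field K using (inv)
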